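{- Let $G=(V,E)$ be the complete graph and let $L$ be a sequence of moves that is valid from some initial configuration $\tau_0\in[3]^V$. Let $t_1<t_2<t_3$ be time steps of three occurrences of a vertex $v$ in $L$ such that $t_1,t_2,t_3$ belong to three different cyclic blocks of $L$. Then there exists a cycle $C\in\Gamma(L)$ over $v$ such that (i) $C$ is leaping, and (ii) $t\in\{t_1,t_1+1,\dots,t_3'\}$ for every $t\in T(C)$, where $t_3'$ is the time step of the last occurrence of $v$ in the cyclic block containing $t_3$.
   Context: A configuration is $\tau\in[3]^V$. A move is $(v,p,q)$ with $p\ne q\in[3]$, valid for $\tau$ if $\tau(v)=p$. A sequence $L$ has moves $L(t)=(v_t,p_t,q_t)$, $t\in[\ell(L)]$; it is valid from $\tau_0$ if each $L(t)$ is valid for $\tau_{t-1}$, where $\tau_t$ is $\tau_{t-1}$ with $v_t$ moved to part $q_t$; an occurrence of $v$ is a time step $t$ with $v_t=v$. A $w$-circuit over $v$ is a set of time steps $t_1<\dots<t_w$ with $v_{t_i}=v$, $q_{t_i}=p_{t_{i+1}}$ ($i<w$), $q_{t_w}=p_{t_1}$; a cycle is an inclusion-wise minimal circuit, $T(C)$ its set of time steps, $\Gamma(L)$ the set of cycles of $L$. A vertex is cyclic in $L$ if some cycle of $L$ is over it, and acyclic otherwise. A block of $L$ is a contiguous subsequence; a cyclic block is a maximal block of $L$ all of whose moves are of cyclic vertices of $L$. A cycle $C$ is leaping if the time steps in $T(C)$ belong to at least two distinct cyclic blocks of $L$. -}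

module Defs where

open import Data.Nat using (ℕ; _≤_; _<_)
open import Data.Fin using (Fin; toℕ; _≟_)
open import Data.List using (List; []; _∷_; _++_; length; lookup)
open import Data.List.Relation.Unary.All using (All)
open import Data.List.Relation.Unary.Linked using (Linked)
open import Data.List.Relation.Binary.Subset.Propositional using (_⊆_)
open import Data.List.Membership.Propositional using (_∈_)
open import Data.Product using (Σ; _×_; ∃; ∃-syntax)
open import Data.Empty using (⊥)
open import Relation.Nullary using (¬_; yes; no)
open import Relation.Binary.PropositionalEquality using (_≡_; _≢_)

-- Vertex set V = Fin n (G is the complete graph on V; edges play no role
-- in the definitions below).  Parts [3] = Fin 3.

Config : ℕ → Set
Config n = Fin n → Fin 3

record Move (n : ℕ) : Set where
  constructor mv
  field
    vtx  : Fin n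
    from : Fin 3
    to   : Fin 3
    from≢to : from ≢ to
open Move public

apply : {n : ℕ} → Config n → Move n → Config n
apply τ m w with w ≟ vtx m
... | yes _ = to m
... | no  _ = τ w

Valid : {n : ℕ} → Config n → List (Move n) → Set
Valid τ [] = Data.Unit.⊤ where import Data.Unit
Valid τ (m ∷ L) = (τ (vtx m) ≡ from m) × Valid (apply τ m) L

-- Time steps of L are Fin (length L) (0-indexed: time step t here is
-- time step t+1 of the paper).
Time : {n : ℕ} → List (Move n) → Set
Time L = Fin (length L)

vAt : {n : ℕ} (L : List (Move n)) → Time L → Fin n
vAt L t = vtx (lookup L t)

pAt qAt : {n : ℕ} (L : List (Move n)) → Time L → Fin 3
pAt L t = from (lookup L t)
qAt L t = to (lookup L t)

_<ₜ_ : {k : ℕ} → Fin k → Fin k → Set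
s <ₜ t = toℕ s < toℕ t

_≤ₜ_ : {k : ℕ} → Fin k → Fin k → Set
s ≤ₜ t = toℕ s ≤ toℕ t

-- A circuit over v, given by its time steps listed increasingly
-- t₁ < … < t_w, with v_{t_i} = v, q_{t_i} = p_{t_{i+1}} and q_{t_w} = p_{t_1}.
IsCircuit : {n : ℕ} (L : List (Move n)) → Fin n → List (Time L) → Set
IsCircuit L v [] = ⊥
IsCircuit L v (t ∷ ts) =
  Linked _<ₜ_ (t ∷ ts)
  × All (λ s → vAt L s ≡ v) (t ∷ ts)
  × Linked (λ a b → qAt L a ≡ pAt L b) ((t ∷ ts) ++ (t ∷ []))

-- A cycle: an inclusion-wise minimal circuit (ts represents T(C)).
IsCycle : {n : ℕ} (L : List (Move n)) → Fin n → List (Time L) → Set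
IsCycle L v ts =
  IsCircuit L v ts
  × (∀ (v' : _) (ts' : List (Time L)) → IsCircuit L v' ts' → ts' ⊆ ts → ts ⊆ ts')

Cyclic : {n : ℕ} (L : List (Move n)) → Fin n → Set
Cyclic L v = ∃[ ts ] IsCycle L v ts

AllCyclic : {n : ℕ} (L : List (Move n)) → Time L → Time L → Set
AllCyclic L a b = ∀ u → a ≤ₜ u → u ≤ₜ b → Cyclic L (vAt L u)

IsCyclicBlock : {n : ℕ} (L : List (Move n)) → Time L → Time L → Set
IsCyclicBlock L a b =
  a ≤ₜ b × AllCyclic L a b
  × (∀ a' b' → a' ≤ₜ a → b ≤ₜ b' → AllCyclic L a' b' → (a' ≡ a × b' ≡ b))

InBlock : {k : ℕ} → Fin k → Fin k → Fin k → Set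
InBlock t a b = a ≤ₜ t × t ≤ₜ b

Leaping : {n : ℕ} (L : List (Move n)) → List (Time L) → Set
Leaping L ts =
  Σ (Time L) λ s → Σ (Time L) λ t → s ∈ ts × t ∈ ts ×
  Σ (Time L) λ a → Σ (Time L) λ b → Σ (Time L) λ c → Σ (Time L) λ d →
  IsCyclicBlock L a b × IsCyclicBlock L c d ×
  InBlock s a b × InBlock t c d × ¬ (a ≡ c × b ≡ d)

module Submission where

-- Distinct cyclic blocks are disjoint maximal runs, so block 1 ends
-- before block 2 starts and block 2 ends before block 3 starts.  Let r be
-- the last occurrence of v in block 1, s the last one in block 2 and s' the
-- first one after block 2 (so s' ≤ t₃ ≤ t₃').  Follow the part of v over
-- time.  If after s' v is back in the part it left at s, then {s, s'} is a
-- 2-cycle leaving block 2.  Otherwise v occupies all three parts at times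
-- s, s + 1, s' + 1, so by time s' + 1 it has returned to the part it left at
-- r; its first return closes a 2- or 3-cycle starting at r whose second step
-- lies beyond block 1.

open import Defs
open import Data.Nat using (ℕ; zero; suc; _+_; _∸_; _≤_; _<_; z≤n; s≤s; s≤s⁻¹; _≤?_; _<?_)
import Data.Nat as ℕ
open import Data.Nat.Properties
  using (≤-refl; ≤-trans; ≤-antisym; <⇒≤; ≤⇒≯; <⇒≱; ≰⇒>; ≤-<-trans; <-≤-trans;
         m≤n⇒m<n∨m≡n; m≤n+m; n≤1+n; n<1+n; m<n⇒m<1+n; <-trans; +-suc; m∸n+n≡m; ≮⇒≥)
open import Data.Fin using (Fin; zero; suc; toℕ; fromℕ<; _≟_)
open import Data.Fin.Properties using (toℕ-injective; toℕ<n; toℕ-fromℕ<; pigeonhole; any?; all?)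
open import Data.Product using (Σ; ∃; ∃₂; _×_; _,_; proj₁; proj₂)
open import Data.List using (List; []; _∷_; _++_; length; lookup)
open import Data.List.Relation.Unary.All as All using (All; []; _∷_)
open import Data.List.Relation.Unary.Linked using (Linked; []; [-]; _∷_; linked?)
open import Data.List.Relation.Unary.Any using (here; there)
open import Data.List.Membership.Propositional using (_∈_)
open import Data.List.Relation.Binary.Subset.Propositional using (_⊆_)
open import Data.Sum using (_⊎_; inj₁; inj₂; [_,_]′)
open import Data.Empty using (⊥-elim)
open import Relation.Nullary using (¬_; Dec; yes; no)
open import Relation.Nullary.Decidable using (_×-dec_; _→-dec_; _⊎-dec_; map′)
open import Relation.Unary using (Decidable)
open import Function using (_∘_)
open import Relation.Binary.PropositionalEquality using (_≡_; _≢_; refl; sym; trans; subst; cong)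

third : (a b c x : Fin 3) → a ≢ b → a ≢ c → b ≢ c → x ≢ a → x ≢ c → x ≡ b
third a b c x a≢b a≢c b≢c x≢a x≢c with pigeonhole ≤-refl values
  where
  values : Fin 4 → Fin 3
  values zero = a
  values (suc zero) = b
  values (suc (suc zero)) = c
  values (suc (suc (suc zero))) = x
... | zero , suc zero , _ , e = ⊥-elim (a≢b e)
... | zero , suc (suc zero) , _ , e = ⊥-elim (a≢c e)
... | zero , suc (suc (suc zero)) , _ , e = ⊥-elim (x≢a (sym e))
... | suc zero , suc (suc zero) , _ , e = ⊥-elim (b≢c e)
... | suc zero , suc (suc (suc zero)) , _ , e = sym e
... | suc (suc zero) , suc (suc (suc zero)) , _ , e = ⊥-elim (x≢c (sym e))
... | _ , zero , () , _
... | suc _ , suc zero , s≤s () , _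
... | suc (suc _) , suc (suc zero) , s≤s (s≤s ()) , _
... | suc (suc (suc _)) , suc (suc (suc zero)) , s≤s (s≤s (s≤s ())) , _

module Search {P : ℕ → Set} (P? : Decidable P) where

  First Last : ℕ → ℕ → Set
  First lo hi = Σ ℕ λ k → lo ≤ k × k ≤ hi × P k × (∀ w → lo ≤ w → w < k → ¬ P w)
  Last lo hi = Σ ℕ λ k → lo ≤ k × k ≤ hi × P k × (∀ w → k < w → w ≤ hi → ¬ P w)

  firstFrom : ∀ d lo → P (d + lo) → First lo (d + lo)
  firstFrom zero lo p = lo , ≤-refl , ≤-refl , p , λ w lo≤w w<lo _ → ≤⇒≯ lo≤w w<lo
  firstFrom (suc d) lo p with P? lo
  ... | yes p-lo = lo , ≤-refl , m≤n+m lo (suc d) , p-lo , λ w lo≤w w<lo _ → ≤⇒≯ lo≤w w<lo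
  ... | no ¬p-lo with firstFrom d (suc lo) (subst P (sym (+-suc d lo)) p)
  ...   | k , lo<k , k≤ , p-k , before =
    k , <⇒≤ lo<k , subst (k ≤_) (+-suc d lo) k≤ , p-k , earlier
    where
    earlier : ∀ w → lo ≤ w → w < k → ¬ P w
    earlier w lo≤w w<k with m≤n⇒m<n∨m≡n lo≤w
    ... | inj₁ lo<w = before w lo<w w<k
    ... | inj₂ refl = ¬p-lo

  first : ∀ {lo hi} → lo ≤ hi → P hi → First lo hi
  first {lo} {hi} lo≤hi p with firstFrom (hi ∸ lo) lo (subst P (sym (m∸n+n≡m lo≤hi)) p)
  ... | k , lo≤k , k≤ , p-k , before = k , lo≤k , subst (k ≤_) (m∸n+n≡m lo≤hi) k≤ , p-k , before

  last : ∀ {lo} hi → lo ≤ hi → P lo → Last lo hi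
  last hi lo≤hi p-lo with P? hi
  ... | yes p-hi = hi , lo≤hi , ≤-refl , p-hi , λ w hi<w w≤hi _ → <⇒≱ hi<w w≤hi
  last zero z≤n p-lo | no ¬p-hi = ⊥-elim (¬p-hi p-lo)
  last (suc h) lo≤hi p-lo | no ¬p-hi with m≤n⇒m<n∨m≡n lo≤hi
  ... | inj₂ refl = ⊥-elim (¬p-hi p-lo)
  ... | inj₁ (s≤s lo≤h) with last h lo≤h p-lo
  ...   | k , lo≤k , k≤h , p-k , after = k , lo≤k , ≤-trans k≤h (n≤1+n h) , p-k , later
    where
    later : ∀ w → k < w → w ≤ suc h → ¬ P w
    later w k<w w≤sh with m≤n⇒m<n∨m≡n w≤sh
    ... | inj₁ (s≤s w≤h) = after w k<w w≤h
    ... | inj₂ refl = ¬p-hi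

  firstArrival : ∀ {lo hi} → lo ≤ hi → ¬ P lo → P hi →
    Σ ℕ λ k → lo ≤ k × suc k ≤ hi × P (suc k) × (∀ w → lo ≤ w → w ≤ k → ¬ P w)
  firstArrival lo≤hi ¬p-lo p-hi with first lo≤hi p-hi
  ... | zero , z≤n , _ , p-0 , _ = ⊥-elim (¬p-lo p-0)
  ... | suc k , lo≤sk , sk≤hi , p-sk , before with m≤n⇒m<n∨m≡n lo≤sk
  ...   | inj₂ refl = ⊥-elim (¬p-lo p-sk)
  ...   | inj₁ (s≤s lo≤k) = k , lo≤k , sk≤hi , p-sk , λ w lo≤w w≤k → before w lo≤w (s≤s w≤k)

module FinSearch {N : ℕ} {P : Fin N → Set} (P? : Decidable P) where

  Pₙ : ℕ → Set
  Pₙ k = ∃ λ t → toℕ t ≡ k × P t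

  open Search {Pₙ} (λ k → any? λ t → (toℕ t ℕ.≟ k) ×-dec P? t)

  FirstIn : ℕ → Fin N → Set
  FirstIn lo hi = Σ (Fin N) λ t → lo ≤ toℕ t × t ≤ₜ hi × P t × (∀ u → lo ≤ toℕ u → u <ₜ t → ¬ P u)

  LastIn : Fin N → ℕ → Set
  LastIn lo hi = Σ (Fin N) λ t → lo ≤ₜ t × toℕ t ≤ hi × P t × (∀ u → t <ₜ u → toℕ u ≤ hi → ¬ P u)

  firstIn : ∀ lo (hi : Fin N) → lo ≤ toℕ hi → P hi → FirstIn lo hi
  firstIn lo hi lo≤hi p-hi with first lo≤hi (hi , refl , p-hi)
  ... | _ , lo≤t , t≤hi , (t , refl , p-t) , before =
    t , lo≤t , t≤hi , p-t , λ u lo≤u u<t p-u → before (toℕ u) lo≤u u<t (u , refl , p-u)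

  lastIn : ∀ lo hi → toℕ lo ≤ hi → P lo → LastIn lo hi
  lastIn lo hi lo≤hi p-lo with last hi lo≤hi (lo , refl , p-lo)
  ... | _ , lo≤t , t≤hi , (t , refl , p-t) , after =
    t , lo≤t , t≤hi , p-t , λ u t<u u≤hi p-u → after (toℕ u) t<u u≤hi (u , refl , p-u)

-- The cyclic blocks of a move
-- sequence are exactly the maximal runs of "the moved vertex is cyclic".
module Runs {N : ℕ} (P : Fin N → Set) where

  AllOn : Fin N → Fin N → Set
  AllOn a b = ∀ t → a ≤ₜ t → t ≤ₜ b → P t

  IsRun : Fin N → Fin N → Set
  IsRun a b = a ≤ₜ b × AllOn a b × (∀ a' b' → a' ≤ₜ a → b ≤ₜ b' → AllOn a' b' → a' ≡ a × b' ≡ b)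

  merge : ∀ {a b c d a' b'} → AllOn a b → AllOn c d → c ≤ₜ b → a ≤ₜ d →
    (a' ≡ a ⊎ a' ≡ c) → (b' ≡ b ⊎ b' ≡ d) → AllOn a' b'
  merge {a} {b} {c} {d} ab cd c≤b a≤d a'∈ b'∈ t a'≤t t≤b'
    with toℕ a ≤? toℕ t | toℕ t ≤? toℕ b
  ... | yes a≤t | yes t≤b = ab t a≤t t≤b
  ... | no a≰t | _ = cd t c≤t (≤-trans (<⇒≤ (≰⇒> a≰t)) a≤d)
    where
    c≤t : c ≤ₜ t
    c≤t = [ (λ a'≡a → ⊥-elim (a≰t (subst (_≤ₜ t) a'≡a a'≤t))) , (λ a'≡c → subst (_≤ₜ t) a'≡c a'≤t) ]′ a'∈
  ... | yes _ | no t≰b = cd t (≤-trans c≤b (<⇒≤ (≰⇒> t≰b))) t≤d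
    where
    t≤d : t ≤ₜ d
    t≤d = [ (λ b'≡b → ⊥-elim (t≰b (subst (t ≤ₜ_) b'≡b t≤b'))) , (λ b'≡d → subst (t ≤ₜ_) b'≡d t≤b') ]′ b'∈

  earlier : (a c : Fin N) → Σ (Fin N) λ a' → (a' ≡ a ⊎ a' ≡ c) × a' ≤ₜ a × a' ≤ₜ c
  earlier a c with toℕ a ≤? toℕ c
  ... | yes a≤c = a , inj₁ refl , ≤-refl , a≤c
  ... | no a≰c = c , inj₂ refl , <⇒≤ (≰⇒> a≰c) , ≤-refl

  later : (b d : Fin N) → Σ (Fin N) λ b' → (b' ≡ b ⊎ b' ≡ d) × b ≤ₜ b' × d ≤ₜ b'
  later b d with toℕ b ≤? toℕ d
  ... | yes b≤d = d , inj₂ refl , b≤d , ≤-refl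
  ... | no b≰d = b , inj₁ refl , ≤-refl , <⇒≤ (≰⇒> b≰d)

  separated : ∀ {a b c d s t} → IsRun a b → IsRun c d → ¬ (a ≡ c × b ≡ d) →
    InBlock s a b → InBlock t c d → s <ₜ t → b <ₜ c
  separated {a} {b} {c} {d} (_ , ab , ab-max) (_ , cd , cd-max) distinct (a≤s , _) (_ , t≤d) s<t
    with toℕ b <? toℕ c
  ... | yes b<c = b<c
  ... | no b≮c with earlier a c | later b d
  ...   | a' , a'∈ , a'≤a , a'≤c | b' , b'∈ , b≤b' , d≤b'
    with ab-max a' b' a'≤a b≤b' union | cd-max a' b' a'≤c d≤b' union
    where
    union : AllOn a' b'
    union = merge ab cd (≮⇒≥ b≮c) (≤-trans a≤s (≤-trans (<⇒≤ s<t) t≤d)) a'∈ b'∈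
  ...   | a'≡a , b'≡b | a'≡c , b'≡d = ⊥-elim (distinct (trans (sym a'≡a) a'≡c , trans (sym b'≡b) b'≡d))

  -- When P is decidable, every point satisfying P lies in a maximal run:
  -- extend [u, u] as far left and as far right as P allows.
  runAround : Decidable P → ∀ u → P u → Σ (Fin N) λ c → Σ (Fin N) λ d → IsRun c d × InBlock u c d
  runAround P? u p-u
    with FinSearch.firstIn (λ c → allOn? c u) 0 u z≤n single
       | FinSearch.lastIn (λ d → allOn? u d) u N (<⇒≤ (toℕ<n u)) single
    where
    allOn? : ∀ a b → Dec (AllOn a b)
    allOn? a b = all? λ t → (toℕ a ≤? toℕ t) →-dec (toℕ t ≤? toℕ b) →-dec P? t
    single : AllOn u u
    single t u≤t t≤u = subst P (toℕ-injective (≤-antisym u≤t t≤u)) p-u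
  ... | c , _ , c≤u , c-u , c-least | d , u≤d , _ , u-d , d-greatest =
    c , d , (≤-trans c≤u u≤d , joined , maximal) , c≤u , u≤d
    where
    joined : AllOn c d
    joined t c≤t t≤d with toℕ t ≤? toℕ u
    ... | yes t≤u = c-u t c≤t t≤u
    ... | no t≰u = u-d t (<⇒≤ (≰⇒> t≰u)) t≤d
    maximal : ∀ a' b' → a' ≤ₜ c → d ≤ₜ b' → AllOn a' b' → a' ≡ c × b' ≡ d
    maximal a' b' a'≤c d≤b' a'-b' =
      toℕ-injective (≤-antisym a'≤c (≮⇒≥ λ a'<c → c-least a' z≤n a'<c a'-u)) ,
      toℕ-injective (≤-antisym (≮⇒≥ λ d<b' → d-greatest b' d<b' (<⇒≤ (toℕ<n b')) u-b') d≤b')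
      where
      a'-u : AllOn a' u
      a'-u t a'≤t t≤u = a'-b' t a'≤t (≤-trans t≤u (≤-trans u≤d d≤b'))
      u-b' : AllOn u b'
      u-b' t u≤t t≤b' = a'-b' t (≤-trans a'≤c (≤-trans c≤u u≤t)) t≤b'

walk-successor : ∀ {A : Set} {R : A → A → Set} {z x : A} xs →
  Linked R (xs ++ z ∷ []) → x ∈ xs → ∃ λ y → (y ∈ xs ⊎ y ≡ z) × R x y
walk-successor (_ ∷ []) (r ∷ [-]) (here refl) = _ , inj₂ refl , r
walk-successor (_ ∷ y ∷ _) (r ∷ _) (here refl) = y , inj₁ (there (here refl)) , r
walk-successor (_ ∷ y ∷ xs) (_ ∷ walk) (there x∈) with walk-successor (y ∷ xs) walk x∈
... | y' , inj₁ y'∈ , r = y' , inj₁ (there y'∈) , r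
... | y' , inj₂ y'≡z , r = y' , inj₂ y'≡z , r

-- Circuits and cycles of a move sequence L.  Since there are only three
-- parts, the cycles are exactly the circuits of length two and three, which
-- makes "v is cyclic" decidable.
module Circuits {n : ℕ} (L : List (Move n)) where

  p q : Time L → Fin 3
  p = pAt L
  q = qAt L

  p≢q : ∀ t → p t ≢ q t
  p≢q t = from≢to (lookup L t)

  hand-over : ∀ {x y} → q x ≡ p y → p x ≢ p y
  hand-over {x} qx≡py px≡py = p≢q x (trans px≡py (sym qx≡py))

  successor : ∀ {w ts x} → IsCircuit L w ts → x ∈ ts → ∃ λ y → y ∈ ts × q x ≡ p y
  successor {ts = t ∷ ts} (_ , _ , walk) x∈ with walk-successor (t ∷ ts) walk x∈
  ... | y , inj₁ y∈ , qx≡py = y , y∈ , qx≡py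
  ... | y , inj₂ refl , qx≡py = y , here refl , qx≡py

  follow : ∀ {w ts S x x'} → IsCircuit L w ts → ts ⊆ S → x ∈ ts →
    (∀ y → y ∈ S → q x ≡ p y → y ≡ x') → x' ∈ ts
  follow c ts⊆S x∈ts only with successor c x∈ts
  ... | y , y∈ts , qx≡py = subst (_∈ _) (only y (ts⊆S y∈ts) qx≡py) y∈ts

  next : ∀ {w t ts} → IsCircuit L w (t ∷ ts) → ∃ λ y → y ∈ ts × t <ₜ y × vAt L y ≡ w
  next {t = t} {ts = []} (_ , _ , qt≡pt ∷ [-]) = ⊥-elim (p≢q t (sym qt≡pt))
  next {ts = y ∷ _} (t<y ∷ _ , _ ∷ vy ∷ _ , _) = y , here refl , t<y , vy

  cycle₂ : ∀ {w i j} → IsCircuit L w (i ∷ j ∷ []) → IsCycle L w (i ∷ j ∷ [])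
  cycle₂ {w} {i} {j} c = c , minimal
    where
    to-j : ∀ y → y ∈ i ∷ j ∷ [] → q i ≡ p y → y ≡ j
    to-j _ (here refl) qi≡pi = ⊥-elim (p≢q i (sym qi≡pi))
    to-j _ (there (here refl)) _ = refl
    to-i : ∀ y → y ∈ i ∷ j ∷ [] → q j ≡ p y → y ≡ i
    to-i _ (here refl) _ = refl
    to-i _ (there (here refl)) qj≡pj = ⊥-elim (p≢q j (sym qj≡pj))
    minimal : ∀ w' ts → IsCircuit L w' ts → ts ⊆ i ∷ j ∷ [] → i ∷ j ∷ [] ⊆ ts
    minimal w' [] ()
    minimal w' (x ∷ ts) c' sub with sub (here refl)
    ... | here refl = All.lookup (here refl ∷ follow c' sub (here refl) to-j ∷ [])
    ... | there (here refl) = All.lookup (follow c' sub (here refl) to-i ∷ here refl ∷ [])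

  -- Every circuit of length three is a cycle: its three steps start in three
  -- different parts, so each step has a unique successor among them.
  cycle₃ : ∀ {w i j k} → IsCircuit L w (i ∷ j ∷ k ∷ []) → IsCycle L w (i ∷ j ∷ k ∷ [])
  cycle₃ {w} {i} {j} {k} c@(_ , _ , qi≡pj ∷ qj≡pk ∷ qk≡pi ∷ [-]) = c , minimal
    where
    S : List (Time L)
    S = i ∷ j ∷ k ∷ []
    to-j : ∀ y → y ∈ S → q i ≡ p y → y ≡ j
    to-j _ (here refl) qi≡pi = ⊥-elim (p≢q i (sym qi≡pi))
    to-j _ (there (here refl)) _ = refl
    to-j _ (there (there (here refl))) qi≡pk = ⊥-elim (p≢q j (trans (sym qi≡pj) (trans qi≡pk (sym qj≡pk))))
    to-k : ∀ y → y ∈ S → q j ≡ p y → y ≡ k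
    to-k _ (here refl) qj≡pi = ⊥-elim (p≢q k (trans (sym qj≡pk) (trans qj≡pi (sym qk≡pi))))
    to-k _ (there (here refl)) qj≡pj = ⊥-elim (p≢q j (sym qj≡pj))
    to-k _ (there (there (here refl))) _ = refl
    to-i : ∀ y → y ∈ S → q k ≡ p y → y ≡ i
    to-i _ (here refl) _ = refl
    to-i _ (there (here refl)) qk≡pj = ⊥-elim (p≢q i (trans (sym qk≡pi) (trans qk≡pj (sym qi≡pj))))
    to-i _ (there (there (here refl))) qk≡pk = ⊥-elim (p≢q k (sym qk≡pk))
    minimal : ∀ w' ts → IsCircuit L w' ts → ts ⊆ S → S ⊆ ts
    minimal w' [] ()
    minimal w' (x ∷ ts) c' sub with sub (here refl)
    ... | here refl = All.lookup (here refl ∷ j∈ ∷ follow c' sub j∈ to-k ∷ [])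
      where
      j∈ : j ∈ i ∷ ts
      j∈ = follow c' sub (here refl) to-j
    ... | there (here refl) = All.lookup (follow c' sub k∈ to-i ∷ here refl ∷ k∈ ∷ [])
      where
      k∈ : k ∈ j ∷ ts
      k∈ = follow c' sub (here refl) to-k
    ... | there (there (here refl)) = All.lookup (i∈ ∷ follow c' sub i∈ to-j ∷ here refl ∷ [])
      where
      i∈ : i ∈ k ∷ ts
      i∈ = follow c' sub (here refl) to-i

  ShortCircuit : Fin n → Set
  ShortCircuit w = (∃₂ λ i j → IsCircuit L w (i ∷ j ∷ []))
                 ⊎ (∃ λ i → ∃₂ λ j k → IsCircuit L w (i ∷ j ∷ k ∷ []))

  -- Every circuit contains a circuit of length two or three: among the parts
  -- p t, p y, p z, p u of four consecutive steps two must agree.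
  shortCircuit : ∀ {w} ts → IsCircuit L w ts → ShortCircuit w
  shortCircuit (t ∷ []) (_ , _ , qt≡pt ∷ [-]) = ⊥-elim (p≢q t (sym qt≡pt))
  shortCircuit (t ∷ y ∷ []) c = inj₁ (t , y , c)
  shortCircuit (t ∷ y ∷ z ∷ []) c = inj₂ (t , y , z , c)
  shortCircuit (t ∷ y ∷ z ∷ u ∷ _)
    (t<y ∷ y<z ∷ _ , vt ∷ vy ∷ vz ∷ _ , qt≡py ∷ qy≡pz ∷ qz≡pu ∷ _) with p z ≟ p t
  ... | yes pz≡pt = inj₁ (t , y , t<y ∷ [-] , vt ∷ vy ∷ [] , qt≡py ∷ trans qy≡pz pz≡pt ∷ [-])
  ... | no pz≢pt with p u ≟ p t
  ...   | yes pu≡pt =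
    inj₂ (t , y , z , t<y ∷ y<z ∷ [-] , vt ∷ vy ∷ vz ∷ [] , qt≡py ∷ qy≡pz ∷ trans qz≡pu pu≡pt ∷ [-])
  ...   | no pu≢pt = inj₁ (y , z , y<z ∷ [-] , vy ∷ vz ∷ [] , qy≡pz ∷ trans qz≡pu pu≡py ∷ [-])
    where
    pu≡py : p u ≡ p y
    pu≡py = third (p t) (p y) (p z) (p u) (hand-over qt≡py) (pz≢pt ∘ sym) (hand-over qy≡pz)
                  pu≢pt (hand-over qz≡pu ∘ sym)

  isCircuit? : ∀ w ts → Dec (IsCircuit L w ts)
  isCircuit? w [] = no λ ()
  isCircuit? w (t ∷ ts) =
    linked? (λ a b → toℕ a <? toℕ b) (t ∷ ts) ×-dec All.all? (λ s → vAt L s ≟ w) (t ∷ ts)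
      ×-dec linked? (λ a b → q a ≟ p b) ((t ∷ ts) ++ t ∷ [])

  cyclic? : ∀ w → Dec (Cyclic L w)
  cyclic? w = map′ toCycle (λ (ts , c , _) → shortCircuit ts c) short?
    where
    short? : Dec (ShortCircuit w)
    short? = (any? λ i → any? λ j → isCircuit? w (i ∷ j ∷ []))
      ⊎-dec (any? λ i → any? λ j → any? λ k → isCircuit? w (i ∷ j ∷ k ∷ []))
    toCycle : ShortCircuit w → Cyclic L w
    toCycle (inj₁ (_ , _ , c)) = _ , cycle₂ c
    toCycle (inj₂ (_ , _ , _ , c)) = _ , cycle₃ c

  open Runs (λ t → Cyclic L (vAt L t))

  -- A set of time steps containing a step s of the cyclic block [a, b] and a
  -- step t of a cyclic vertex after b is leaping: t lies in another block.
  leaping : ∀ {C a b s t} → IsCyclicBlock L a b → s ∈ C → InBlock s a b →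
    t ∈ C → b <ₜ t → Cyclic L (vAt L t) → Leaping L C
  leaping {a = a} {b} {s} {t} block s∈C s∈block t∈C b<t cyclic-t
    with runAround (λ u → cyclic? (vAt L u)) t cyclic-t
  ... | c , d , block' , t∈block' =
    s , t , s∈C , t∈C , a , b , c , d , block , block' , s∈block , t∈block' ,
    λ (_ , b≡d) → <⇒≱ b<t (subst (toℕ t ≤_) (cong toℕ (sym b≡d)) (proj₂ t∈block'))

-- The configuration after the first k moves of L (after all of them if k ≥ |L|).
conf : {n : ℕ} → Config n → List (Move n) → ℕ → Config n
conf τ L zero = τ
conf τ [] (suc k) = τ
conf τ (m ∷ L) (suc k) = conf (apply τ m) L k

conf-step : {n : ℕ} (τ : Config n) (L : List (Move n)) (t : Time L) →
  conf τ L (suc (toℕ t)) ≡ apply (conf τ L (toℕ t)) (lookup L t)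
conf-step τ (m ∷ L) zero = refl
conf-step τ (m ∷ L) (suc t) = conf-step (apply τ m) L t

conf-valid : {n : ℕ} (τ : Config n) (L : List (Move n)) → Valid τ L → (t : Time L) →
  conf τ L (toℕ t) (vAt L t) ≡ pAt L t
conf-valid τ (m ∷ L) (valid-m , _) zero = valid-m
conf-valid τ (m ∷ L) (_ , valid-L) (suc t) = conf-valid (apply τ m) L valid-L t

apply-moved : {n : ℕ} (τ : Config n) (m : Move n) → apply τ m (vtx m) ≡ to m
apply-moved τ m with vtx m ≟ vtx m
... | yes _ = refl
... | no ne = ⊥-elim (ne refl)

apply-other : {n : ℕ} (τ : Config n) (m : Move n) {w : Fin n} → w ≢ vtx m → apply τ m w ≡ τ w
apply-other τ m {w} w≢ with w ≟ vtx m
... | yes eq = ⊥-elim (w≢ eq)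
... | no _ = refl

module Trajectory {n : ℕ} (τ₀ : Config n) (L : List (Move n)) (valid : Valid τ₀ L) (v : Fin n) where
  open Circuits L using (p; q; p≢q; cycle₂; cycle₃; next; leaping)

  N : ℕ
  N = length L

  Occ : Time L → Set
  Occ t = vAt L t ≡ v

  occ? : Decidable Occ
  occ? t = vAt L t ≟ v

  pos : ℕ → Fin 3
  pos k = conf τ₀ L k v

  Between : ℕ → ℕ → List (Time L) → Set
  Between lo hi = All (λ t → lo ≤ toℕ t × toℕ t ≤ hi)

  at-start : ∀ {t} → Occ t → pos (toℕ t) ≡ p t
  at-start {t} occ = subst (λ w → conf τ₀ L (toℕ t) w ≡ p t) occ (conf-valid τ₀ L valid t)

  at-end : ∀ {t} → Occ t → pos (suc (toℕ t)) ≡ q t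
  at-end {t} occ = trans (cong (λ τ → τ v) (conf-step τ₀ L t))
    (subst (λ w → apply (conf τ₀ L (toℕ t)) (lookup L t) w ≡ q t) occ (apply-moved _ (lookup L t)))

  idle : ∀ {t} → ¬ Occ t → pos (suc (toℕ t)) ≡ pos (toℕ t)
  idle {t} ¬occ = trans (cong (λ τ → τ v) (conf-step τ₀ L t)) (apply-other _ (lookup L t) (¬occ ∘ sym))

  departs : ∀ {t} → Occ t → pos (suc (toℕ t)) ≢ pos (toℕ t)
  departs {t} occ e = p≢q t (trans (sym (at-start occ)) (trans (sym e) (at-end occ)))

  link : ∀ {x y} → Occ x → Occ y → pos (suc (toℕ x)) ≡ pos (toℕ y) → q x ≡ p y
  link occ-x occ-y e = trans (sym (at-end occ-x)) (trans e (at-start occ-y))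

  idle-at : ∀ k (k<N : k < N) → ¬ Occ (fromℕ< k<N) → pos (suc k) ≡ pos k
  idle-at k k<N ¬occ = subst (λ j → pos (suc j) ≡ pos j) (toℕ-fromℕ< k<N) (idle ¬occ)

  steady : ∀ {i} j → i ≤ j → j ≤ N → (∀ t → i ≤ toℕ t → toℕ t < j → ¬ Occ t) → pos j ≡ pos i
  steady zero z≤n _ _ = refl
  steady {i} (suc j) i≤sj sj≤N quiet with m≤n⇒m<n∨m≡n i≤sj
  ... | inj₂ refl = refl
  ... | inj₁ (s≤s i≤j) =
    trans (idle-at j sj≤N (quiet (fromℕ< sj≤N) i≤t t<sj))
          (steady j i≤j (<⇒≤ sj≤N) λ t i≤t t<j → quiet t i≤t (m<n⇒m<1+n t<j))
    where
    i≤t : i ≤ toℕ (fromℕ< sj≤N)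
    i≤t = subst (i ≤_) (sym (toℕ-fromℕ< sj≤N)) i≤j
    t<sj : toℕ (fromℕ< sj≤N) < suc j
    t<sj = subst (_< suc j) (sym (toℕ-fromℕ< sj≤N)) (n<1+n j)

  moved : ∀ k → k < N → pos (suc k) ≢ pos k → ∃ λ t → toℕ t ≡ k × Occ t
  moved k k<N changed with occ? (fromℕ< k<N)
  ... | yes occ = fromℕ< k<N , toℕ-fromℕ< k<N , occ
  ... | no ¬occ = ⊥-elim (changed (idle-at k k<N ¬occ))

  -- If v leaves its part A at step r and is in A again at
  -- time u, a cycle over v starts at r and ends before u.  It is closed by
  -- the step m at which v first comes back to A: directly if v left r's
  -- target part B at m, and otherwise through the step at which v first
  -- reaches the part C it leaves at m.
  returnCycle : ∀ r → Occ r → ∀ u → toℕ r < u → u ≤ N → pos u ≡ pos (toℕ r) →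
    Σ (List (Time L)) λ rest → IsCycle L v (r ∷ rest) × All (λ t → toℕ r ≤ toℕ t × toℕ t < u) (r ∷ rest)
  returnCycle r occ-r u r<u u≤N back
    with Search.firstArrival (λ k → pos k ≟ pos (toℕ r)) r<u (departs occ-r) back
  ... | m₀ , r<m₀ , m₀<u , arrive , away
    with moved m₀ (<-≤-trans m₀<u u≤N) (λ e → away m₀ r<m₀ ≤-refl (trans (sym e) arrive))
  ... | m , refl , occ-m with pos (toℕ m) ≟ pos (suc (toℕ r))
  ...   | yes pm≡B =
    m ∷ [] ,
    cycle₂ (r<m₀ ∷ [-] , occ-r ∷ occ-m ∷ [] , link occ-r occ-m (sym pm≡B) ∷ link occ-m occ-r arrive ∷ [-]) ,
    (≤-refl , r<u) ∷ (<⇒≤ r<m₀ , m₀<u) ∷ []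
  ...   | no pm≢B
    with Search.firstArrival (λ k → pos k ≟ pos (toℕ m)) r<m₀ (pm≢B ∘ sym) refl
  ...   | m'₀ , r<m'₀ , m'₀<m , arrive' , away'
    with moved m'₀ (<-trans m'₀<m (toℕ<n m)) (λ e → away' m'₀ r<m'₀ ≤-refl (trans (sym e) arrive'))
  ...   | m' , refl , occ-m' =
    m' ∷ m ∷ [] ,
    cycle₃ (r<m'₀ ∷ m'₀<m ∷ [-] , occ-r ∷ occ-m' ∷ occ-m ∷ [] ,
            link occ-r occ-m' (sym pm'≡B) ∷ link occ-m' occ-m arrive' ∷ link occ-m occ-r arrive ∷ [-]) ,
    (≤-refl , r<u) ∷ (<⇒≤ r<m'₀ , <-trans m'₀<m m₀<u) ∷ (<⇒≤ r<m₀ , m₀<u) ∷ []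
    where
    pm'≡B : pos (toℕ m') ≡ pos (suc (toℕ r))
    pm'≡B = third (pos (toℕ r)) (pos (suc (toℕ r))) (pos (toℕ m)) (pos (toℕ m'))
      (departs occ-r ∘ sym) (away (toℕ m) r<m₀ ≤-refl ∘ sym) (pm≢B ∘ sym)
      (away (toℕ m') r<m'₀ (<⇒≤ m'₀<m)) (away' (toℕ m') r<m'₀ ≤-refl)

  CycleBetween : Time L → Time L → Time L → Set
  CycleBetween r s s' =
    (Σ (List (Time L)) λ C → IsCycle L v C × s ∈ C × s' ∈ C × Between (toℕ r) (toℕ s') C)
    ⊎ (Σ (List (Time L)) λ rest → IsCycle L v (r ∷ rest) × Between (toℕ r) (toℕ s') (r ∷ rest))

  -- Either
  -- s, s' form a 2-cycle, or v is at time s, s + 1 or s' + 1 in the part it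
  -- leaves at r (the parts at these times are then all different), and the
  -- return lemma gives a cycle starting at r.
  cycleBetween : ∀ r s s' → Occ r → Occ s → Occ s' → r <ₜ s → s <ₜ s' →
    (∀ t → s <ₜ t → t <ₜ s' → ¬ Occ t) → CycleBetween r s s'
  cycleBetween r s s' occ-r occ-s occ-s' r<s s<s' gap = decide (pos (suc (toℕ s')) ≟ pos (toℕ s))
    where
    A X Y Z : Fin 3
    A = pos (toℕ r)
    X = pos (toℕ s)
    Y = pos (suc (toℕ s))
    Z = pos (suc (toℕ s'))

    s'-starts-at-Y : pos (toℕ s') ≡ Y
    s'-starts-at-Y = steady (toℕ s') s<s' (<⇒≤ (toℕ<n s')) gap

    returnBy : ∀ u → toℕ r < u → u ≤ suc (toℕ s') → pos u ≡ A →
      Σ (List (Time L)) λ rest → IsCycle L v (r ∷ rest) × Between (toℕ r) (toℕ s') (r ∷ rest)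
    returnBy u r<u u≤ back with returnCycle r occ-r u r<u (≤-trans u≤ (toℕ<n s')) back
    ... | rest , cycle , inside = rest , cycle , All.map (λ (r≤t , t<u) → r≤t , s≤s⁻¹ (≤-trans t<u u≤)) inside

    decide : Dec (Z ≡ X) → CycleBetween r s s'
    decide (yes Z≡X) =
      inj₁ (s ∷ s' ∷ [] ,
            cycle₂ (s<s' ∷ [-] , occ-s ∷ occ-s' ∷ [] ,
                    link occ-s occ-s' (sym s'-starts-at-Y) ∷ link occ-s' occ-s Z≡X ∷ [-]) ,
            here refl , there (here refl) ,
            (<⇒≤ r<s , <⇒≤ s<s') ∷ (<⇒≤ (<-trans r<s s<s') , ≤-refl) ∷ [])
    decide (no Z≢X) with A ≟ X | A ≟ Z
    ... | yes A≡X | _ = inj₂ (returnBy (toℕ s) r<s (≤-trans (<⇒≤ s<s') (n≤1+n _)) (sym A≡X))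
    ... | no _ | yes A≡Z = inj₂ (returnBy (suc (toℕ s')) (<-trans r<s (m<n⇒m<1+n s<s')) ≤-refl (sym A≡Z))
    ... | no A≢X | no A≢Z = inj₂ (returnBy (suc (toℕ s)) (m<n⇒m<1+n r<s) (s≤s (<⇒≤ s<s')) (sym A≡Y))
      where
      A≡Y : A ≡ Y
      A≡Y = third X Y Z A (departs occ-s ∘ sym) (Z≢X ∘ sym)
        (λ Y≡Z → departs occ-s' (trans (sym Y≡Z) (sym s'-starts-at-Y))) A≢X A≢Z

  -- Let r be the last occurrence of v in a cyclic block [a₁, b₁],
  -- s an occurrence of v in a later cyclic block [a₂, b₂], and s' the next
  -- occurrence of v after s, lying beyond b₂.  Then a leaping cycle over v
  -- lies within [r, s']: a 2-cycle {s, s'} leaves block [a₂, b₂], and a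
  -- cycle starting at r leaves [a₁, b₁] at its second step.
  leapingCycle : ∀ {a₁ b₁ a₂ b₂} r s s' → Cyclic L v →
    IsCyclicBlock L a₁ b₁ → Occ r → InBlock r a₁ b₁ → (∀ t → r <ₜ t → t ≤ₜ b₁ → ¬ Occ t) →
    b₁ <ₜ a₂ → IsCyclicBlock L a₂ b₂ → Occ s → InBlock s a₂ b₂ →
    Occ s' → b₂ <ₜ s' → (∀ t → s <ₜ t → t <ₜ s' → ¬ Occ t) →
    Σ (List (Time L)) λ C → IsCycle L v C × Leaping L C × Between (toℕ r) (toℕ s') C
  leapingCycle r s s' cyclic-v B₁ occ-r r∈B₁ r-last b₁<a₂ B₂ occ-s s∈B₂ occ-s' b₂<s' gap
    with cycleBetween r s s' occ-r occ-s occ-s'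
              (≤-<-trans (proj₂ r∈B₁) (<-≤-trans b₁<a₂ (proj₁ s∈B₂))) (≤-<-trans (proj₂ s∈B₂) b₂<s') gap
  ... | inj₁ (C , cycle , s∈C , s'∈C , inside) =
    C , cycle , leaping B₂ s∈C s∈B₂ s'∈C b₂<s' (subst (Cyclic L) (sym occ-s') cyclic-v) , inside
  ... | inj₂ (rest , cycle , inside) with next (proj₁ cycle)
  ...   | y , y∈rest , r<y , occ-y =
    r ∷ rest , cycle ,
    leaping B₁ (here refl) r∈B₁ (there y∈rest) (≰⇒> λ y≤b₁ → r-last y r<y y≤b₁ occ-y)
            (subst (Cyclic L) (sym occ-y) cyclic-v) ,
    inside

lemma4p17 : (n : ℕ) (τ₀ : Config n) (L : List (Move n)) → Valid τ₀ L →
    (v : Fin n) (t₁ t₂ t₃ : Time L) →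
    t₁ <ₜ t₂ → t₂ <ₜ t₃ →
    vAt L t₁ ≡ v → vAt L t₂ ≡ v → vAt L t₃ ≡ v →
    (a₁ b₁ a₂ b₂ a₃ b₃ : Time L) →
    IsCyclicBlock L a₁ b₁ → IsCyclicBlock L a₂ b₂ → IsCyclicBlock L a₃ b₃ →
    InBlock t₁ a₁ b₁ → InBlock t₂ a₂ b₂ → InBlock t₃ a₃ b₃ →
    ¬ (a₁ ≡ a₂ × b₁ ≡ b₂) → ¬ (a₂ ≡ a₃ × b₂ ≡ b₃) → ¬ (a₁ ≡ a₃ × b₁ ≡ b₃) →
    (t₃' : Time L) → vAt L t₃' ≡ v → InBlock t₃' a₃ b₃ →
    (∀ s → vAt L s ≡ v → InBlock s a₃ b₃ → s ≤ₜ t₃') →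
    Σ (List (Time L)) λ C → IsCycle L v C × Leaping L C ×
    All (λ t → t₁ ≤ₜ t × t ≤ₜ t₃') C
lemma4p17 n τ₀ L valid v t₁ t₂ t₃ t₁<t₂ t₂<t₃ occ₁ occ₂ occ₃ a₁ b₁ a₂ b₂ a₃ b₃
  B₁ B₂ B₃ t₁∈B₁ t₂∈B₂ t₃∈B₃ B₁≢B₂ B₂≢B₃ _ t₃' _ _ t₃'-last =
  conclude (lastIn t₁ (toℕ b₁) (proj₂ t₁∈B₁) occ₁)
           (lastIn t₂ (toℕ b₂) (proj₂ t₂∈B₂) occ₂)
           (firstIn (suc (toℕ b₂)) t₃ (<-≤-trans b₂<a₃ (proj₁ t₃∈B₃)) occ₃)
  where
  open Trajectory τ₀ L valid v
  open FinSearch occ?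
  open Runs (λ t → Cyclic L (vAt L t)) using (separated)

  b₁<a₂ : b₁ <ₜ a₂
  b₁<a₂ = separated B₁ B₂ B₁≢B₂ t₁∈B₁ t₂∈B₂ t₁<t₂
  b₂<a₃ : b₂ <ₜ a₃
  b₂<a₃ = separated B₂ B₃ B₂≢B₃ t₂∈B₂ t₃∈B₃ t₂<t₃

  cyclic-v : Cyclic L v
  cyclic-v = subst (Cyclic L) occ₁ (proj₁ (proj₂ B₁) t₁ (proj₁ t₁∈B₁) (proj₂ t₁∈B₁))

  conclude : LastIn t₁ (toℕ b₁) → LastIn t₂ (toℕ b₂) → FirstIn (suc (toℕ b₂)) t₃ →
    Σ (List (Time L)) λ C → IsCycle L v C × Leaping L C × All (λ t → t₁ ≤ₜ t × t ≤ₜ t₃') C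
  conclude (r , t₁≤r , r≤b₁ , occ-r , r-last) (s , t₂≤s , s≤b₂ , occ-s , s-last)
           (s' , b₂<s' , s'≤t₃ , occ-s' , s'-first)
    with leapingCycle r s s' cyclic-v B₁ occ-r (≤-trans (proj₁ t₁∈B₁) t₁≤r , r≤b₁) r-last
           b₁<a₂ B₂ occ-s (≤-trans (proj₁ t₂∈B₂) t₂≤s , s≤b₂) occ-s' b₂<s' gap
    where
    gap : ∀ t → s <ₜ t → t <ₜ s' → ¬ Occ t
    gap t s<t t<s' with toℕ t ≤? toℕ b₂
    ... | yes t≤b₂ = s-last t s<t t≤b₂
    ... | no t≰b₂ = s'-first t (≰⇒> t≰b₂) t<s'
  ... | C , cycle , leap , inside =
    C , cycle , leap ,
    All.map (λ (r≤t , t≤s') → ≤-trans t₁≤r r≤t , ≤-trans t≤s' (≤-trans s'≤t₃ (t₃'-last t₃ occ₃ t₃∈B₃))) inside
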